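{- The map $\pi:\mathcal S\to\mathscr G$, $(\pi\alpha)(u)=(u\circ\alpha)_\infty$, is well defined (each $\pi\alpha$ is a character) and is a ring homomorphism from $(\mathcal S,+,\cdot)$ to $(\mathscr G,\oplus,\odot)$, whose kernel $\{\alpha\in\mathcal S:\pi\alpha=\theta\}$ is the ideal $\mathscr C_0$ of zero stabilizers.
   Context: $\mathscr A$ is the commutative algebra (pointwise operations) of all complex-valued periodic functions on $\mathbb Z$; $\mathscr G$ is the set of its characters (nonzero linear multiplicative functionals $\mathscr A\to\mathbb C$). For characters $\phi,\psi$ and $w:\mathbb Z^2\to\mathbb C$ periodic in each variable, $\phi_x\psi_yw(x,y)$ means $\phi$ applied to $x\mapsto\psi(y\mapsto w(x,y))$; $(\phi\oplus\psi)(u)=\phi_x\psi_yu(x+y)$, $(\phi\odot\psi)(u)=\phi_x\psi_yu(xy)$, $\theta(u)=u(0)$. A sequence $\alpha:\mathbb N\to\mathbb Z$ stabilizes $u$ at the final value $(u\circ\alpha)_\infty=v$ if $u(\alpha_n)=v$ for all but finitely many $n$; $\alpha$ is a stabilizer if it stabilizes every $u\in\mathscr A$. $\mathcal S$ is the ring of all stabilizers with pointwise operations. $\mathscr C_0$ is the set of integer sequences $\beta$ such that for every positive integer $n$, $\beta_k\equiv0\pmod n$ for all but finitely many $k$; zero stabilizers are stabilizers $\alpha$ with $(u\circ\alpha)_\infty=u(0)$ for all $u\in\mathscr A$. -}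

module Defs where

open import Level using (Level; _⊔_)
open import Algebra.Bundles using (CommutativeRing)
open import Data.Nat as ℕ using (ℕ)
open import Data.Integer as ℤ using (ℤ; +_; 0ℤ; 1ℤ)
open import Data.Integer.Properties as ℤP using ()
open import Data.Integer.Divisibility using (_∣_)
open import Data.Product using (Σ; _×_; _,_; proj₁; proj₂; ∃)
open import Relation.Nullary using (¬_)
open import Relation.Binary.PropositionalEquality as Eq using (_≡_; subst)

Eventually : ∀ {p} → (ℕ → Set p) → Set p
Eventually P = Σ ℕ λ N → ∀ n → N ℕ.≤ n → P n

C₀ : (ℕ → ℤ) → Set
C₀ β = ∀ n → 0 ℕ.< n → Eventually (λ k → + n ∣ β k)

_+ₛ_ : (ℕ → ℤ) → (ℕ → ℤ) → (ℕ → ℤ)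
(α +ₛ β) n = α n ℤ.+ β n

_*ₛ_ : (ℕ → ℤ) → (ℕ → ℤ) → (ℕ → ℤ)
(α *ₛ β) n = α n ℤ.* β n

oneₛ : ℕ → ℤ
oneₛ _ = 1ℤ

IsFieldCR : ∀ {c ℓ} → CommutativeRing c ℓ → Set (c ⊔ ℓ)
IsFieldCR R = (¬ (1# ≈ 0#)) × (∀ x → ¬ (x ≈ 0#) → Σ Carrier λ y → x * y ≈ 1#)
  where open CommutativeRing R

module Theory {c ℓ} (R : CommutativeRing c ℓ) where
  open CommutativeRing R

  Periodic : (ℤ → Carrier) → Set ℓ
  Periodic u = Σ ℕ λ p → (0 ℕ.< p) × (∀ x m → u (x ℤ.+ m ℤ.* + p) ≈ u x)

  record 𝒜 : Set (c ⊔ ℓ) where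
    constructor mk𝒜
    field
      fn  : ℤ → Carrier
      per : Periodic fn
  open 𝒜 public

  private
    transport : ∀ (u : ℤ → Carrier) {x y} → x ≡ y → u x ≈ u y
    transport u e = reflexive (Eq.cong u e)

    period-lemma : ∀ (p q : ℕ) (m : ℤ) → m ℤ.* + (p ℕ.* q) ≡ (m ℤ.* + q) ℤ.* + p
    period-lemma p q m =
      Eq.trans (Eq.cong (λ z → m ℤ.* z) (Eq.trans (ℤP.pos-* p q) (ℤP.*-comm (+ p) (+ q))))
               (Eq.sym (ℤP.*-assoc m (+ q) (+ p)))

    period-lemma₂ : ∀ (p q : ℕ) (m : ℤ) → m ℤ.* + (p ℕ.* q) ≡ (m ℤ.* + p) ℤ.* + q
    period-lemma₂ p q m =
      Eq.trans (Eq.cong (λ z → m ℤ.* z) (ℤP.pos-* p q)) (Eq.sym (ℤP.*-assoc m (+ p) (+ q)))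

    pos* : ∀ {p q} → 0 ℕ.< p → 0 ℕ.< q → 0 ℕ.< p ℕ.* q
    pos* {ℕ.suc p} {ℕ.suc q} _ _ = ℕ.s≤s ℕ.z≤n


  _+𝒜_ : 𝒜 → 𝒜 → 𝒜
  mk𝒜 f (p , p>0 , hf) +𝒜 mk𝒜 g (q , q>0 , hg) =
    mk𝒜 (λ x → f x + g x)
        (p ℕ.* q , pos* p>0 q>0 , λ x m →
          +-cong (trans (transport f (Eq.cong (λ z → x ℤ.+ z) (period-lemma p q m))) (hf x (m ℤ.* + q)))
                 (trans (transport g (Eq.cong (λ z → x ℤ.+ z) (period-lemma₂ p q m))) (hg x (m ℤ.* + p))))

  _*𝒜_ : 𝒜 → 𝒜 → 𝒜
  mk𝒜 f (p , p>0 , hf) *𝒜 mk𝒜 g (q , q>0 , hg) =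
    mk𝒜 (λ x → f x * g x)
        (p ℕ.* q , pos* p>0 q>0 , λ x m →
          *-cong (trans (transport f (Eq.cong (λ z → x ℤ.+ z) (period-lemma p q m))) (hf x (m ℤ.* + q)))
                 (trans (transport g (Eq.cong (λ z → x ℤ.+ z) (period-lemma₂ p q m))) (hg x (m ℤ.* + p))))

  _·𝒜_ : Carrier → 𝒜 → 𝒜
  a ·𝒜 mk𝒜 f (p , p>0 , hf) = mk𝒜 (λ x → a * f x) (p , p>0 , λ x m → *-congˡ (hf x m))

  _≈𝒜_ : 𝒜 → 𝒜 → Set ℓ
  u ≈𝒜 v = ∀ x → fn u x ≈ fn v x

  -- a character: nonzero linear multiplicative functional 𝒜 → K
  -- (cong: it is a function on 𝒜, whose equality is pointwise ≈)
  record IsCharacter (φ : 𝒜 → Carrier) : Set (c ⊔ ℓ) where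
    field
      cong           : ∀ {u v} → u ≈𝒜 v → φ u ≈ φ v
      additive       : ∀ u v → φ (u +𝒜 v) ≈ φ u + φ v
      homogeneous    : ∀ a u → φ (a ·𝒜 u) ≈ a * φ u
      multiplicative : ∀ u v → φ (u *𝒜 v) ≈ φ u * φ v
      nonzero        : Σ 𝒜 λ u → ¬ (φ u ≈ 0#)

  𝒢 : Set (c ⊔ ℓ)
  𝒢 = Σ (𝒜 → Carrier) IsCharacter

  _≈ᶠ_ : (𝒜 → Carrier) → (𝒜 → Carrier) → Set (c ⊔ ℓ)
  φ ≈ᶠ ψ = ∀ u → φ u ≈ ψ u

  shiftAt : ℤ → 𝒜 → 𝒜
  shiftAt x (mk𝒜 f (p , p>0 , hf)) =
    mk𝒜 (λ y → f (x ℤ.+ y))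
        (p , p>0 , λ y m → trans (transport f (Eq.sym (ℤP.+-assoc x y (m ℤ.* + p)))) (hf (x ℤ.+ y) m))

  mulAt : ℤ → 𝒜 → 𝒜
  mulAt x (mk𝒜 f (p , p>0 , hf)) =
    mk𝒜 (λ y → f (x ℤ.* y))
        (p , p>0 , λ y m → trans (transport f
                               (Eq.trans (ℤP.*-distribˡ-+ x y (m ℤ.* + p))
                                         (Eq.cong (λ z → x ℤ.* y ℤ.+ z) (Eq.sym (ℤP.*-assoc x m (+ p))))))
                             (hf (x ℤ.* y) (x ℤ.* m)))

  _⊕_ : 𝒢 → 𝒢 → (𝒜 → Carrier)
  ((φ , _) ⊕ (ψ , cψ)) u@(mk𝒜 f (p , p>0 , hf)) =
    φ (mk𝒜 (λ x → ψ (shiftAt x u))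
           (p , p>0 , λ x m → IsCharacter.cong cψ λ y →
              trans (transport f (Eq.trans (ℤP.+-assoc x (m ℤ.* + p) y)
                                  (Eq.trans (Eq.cong (λ z → x ℤ.+ z) (ℤP.+-comm (m ℤ.* + p) y))
                                            (Eq.sym (ℤP.+-assoc x y (m ℤ.* + p))))))
                    (hf (x ℤ.+ y) m)))

  _⊙_ : 𝒢 → 𝒢 → (𝒜 → Carrier)
  ((φ , _) ⊙ (ψ , cψ)) u@(mk𝒜 f (p , p>0 , hf)) =
    φ (mk𝒜 (λ x → ψ (mulAt x u))
           (p , p>0 , λ x m → IsCharacter.cong cψ λ y →
              trans (transport f (Eq.trans (ℤP.*-distribʳ-+ y x (m ℤ.* + p))
                                  (Eq.cong (λ z → x ℤ.* y ℤ.+ z)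
                                    (Eq.trans (ℤP.*-assoc m (+ p) y)
                                      (Eq.trans (Eq.cong (λ z → m ℤ.* z) (ℤP.*-comm (+ p) y))
                                                (Eq.sym (ℤP.*-assoc m y (+ p))))))))
                    (hf (x ℤ.* y) (m ℤ.* y))))

  -- θ(u) = u(0), and evaluation at 1 (the unit of ⊙)
  θ : 𝒜 → Carrier
  θ u = fn u 0ℤ

  ev₁ : 𝒜 → Carrier
  ev₁ u = fn u 1ℤ

  FinalValue : (ℕ → ℤ) → 𝒜 → Carrier → Set ℓ
  FinalValue α u v = Eventually (λ n → fn u (α n) ≈ v)

  Stabilizer : (ℕ → ℤ) → Set (c ⊔ ℓ)
  Stabilizer α = ∀ (u : 𝒜) → Σ Carrier (FinalValue α u)

  ZeroStabilizer : (ℕ → ℤ) → Set (c ⊔ ℓ)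
  ZeroStabilizer α = ∀ (u : 𝒜) → FinalValue α u (fn u 0ℤ)

  π : ∀ {α} → Stabilizer α → (𝒜 → Carrier)
  π s u = proj₁ (s u)

module Submission where

-- Everything rests on two facts about a stabilizer α.
--   (1) A final value is a limit along the cofinite filter, hence unique
--       (limit-unique); so any identity holding eventually along α passes to
--       final values.  This shows that π α is a character, that π 1 = ev₁, and
--       that π α = θ exactly when α is a zero stabilizer.
--   (2) A stabilizer is eventually constant modulo every p > 0
--       (stabilizer-constantMod): it stabilizes the indicators of the p residue
--       classes, and the class of α M, for M past all their thresholds, has
--       final value 1.
-- From (2), for a p-periodic u and an operation op respecting congruence mod p
-- in its second argument, u (op x (β n)) already equals the inner final value
-- π β (y ↦ u (op x y)) for all large n, uniformly in x; with (1) this gives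
-- π (α op β) = π α ∘ π β (π-op), i.e. the ⊕ and ⊙ laws for op = + and op = *.
-- Finally C₀ is the set of zero stabilizers: one direction uses the indicator
-- of 0 mod n, the other the periodicity of u.

open import Defs
open import Algebra.Bundles using (CommutativeRing)
open import Data.Nat using (ℕ; zero; suc; _≤_; _<_; _⊔_; z<s; NonZero; >-nonZero)
open import Data.Integer as ℤ using (ℤ; +_; 0ℤ)
open import Data.Product using (Σ; _×_; _,_; proj₁; proj₂)
open import Data.Sum using (inj₁; inj₂)
open import Data.Nat.Properties using (≤-refl; ≤-trans; m≤m⊔n; m≤n⊔m; m<n⇒m<1+n; m<1+n⇒m<n∨m≡n)
open import Data.Integer.Properties using (+-identityʳ; +-inverseʳ)
open import Data.Integer.DivMod using (_%ℕ_; _/ℕ_; n%ℕd<d; a≡a%ℕn+[a/ℕn]*n)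
import Data.Integer.Divisibility as Unsigned
open import Data.Integer.Divisibility.Signed
  using (_∣_; divides; _∣?_; ∣ᵤ⇒∣; ∣⇒∣ᵤ; ∣m⇒∣-m; ∣m∣n⇒∣m+n; ∣n⇒∣m*n; ∣-refl)
open import Data.Integer.Solver using (module +-*-Solver)
open +-*-Solver using (solve; _:=_; _:+_; _:*_; _:-_; :-_)
open import Relation.Nullary using (¬_; Dec; yes; no)
open import Relation.Nullary.Decidable using (map′)
open import Data.Empty using (⊥-elim)
open import Relation.Binary.PropositionalEquality using (_≡_; refl; cong; subst)
import Relation.Binary.PropositionalEquality as Eq

eventually-map : ∀ {p q} {P : ℕ → Set p} {Q : ℕ → Set q} → (∀ n → P n → Q n) → Eventually P → Eventually Q
eventually-map f (N , h) = N , λ n N≤n → f n (h n N≤n)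

eventually-zip : ∀ {p q r} {P : ℕ → Set p} {Q : ℕ → Set q} {R : ℕ → Set r} →
                 (∀ n → P n → Q n → R n) → Eventually P → Eventually Q → Eventually R
eventually-zip f (N₁ , h₁) (N₂ , h₂) =
  N₁ ⊔ N₂ , λ n le → f n (h₁ n (≤-trans (m≤m⊔n N₁ N₂) le)) (h₂ n (≤-trans (m≤n⊔m N₁ N₂) le))

eventually-all : ∀ {p} {P : ℕ → ℕ → Set p} (k : ℕ) →
                 (∀ i → i < k → Eventually (P i)) → Eventually (λ n → ∀ i → i < k → P i n)
eventually-all zero    ev = 0 , λ _ _ _ ()
eventually-all {P = P} (suc k) ev =
  eventually-zip combine (ev k ≤-refl) (eventually-all k λ i i<k → ev i (m<n⇒m<1+n i<k))
  where
  combine : ∀ n → P k n → (∀ i → i < k → P i n) → ∀ i → i < suc k → P i n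
  combine n Pk below i i<1+k with m<1+n⇒m<n∨m≡n i<1+k
  ... | inj₁ i<k  = below i i<k
  ... | inj₂ refl = Pk

eventually-witness : ∀ {p} {P : ℕ → Set p} → Eventually P → Σ ℕ P
eventually-witness (N , h) = N , h N ≤-refl

eventually-≥ : (M : ℕ) → Eventually (M ≤_)
eventually-≥ M = M , λ _ le → le

-- Congruence of integers modulo a natural number.  It is a record (rather than
-- a synonym for divisibility) so that x, y and p can be inferred from proofs.

infix 4 _≡_mod_ _≡?_mod_

record _≡_mod_ (x y : ℤ) (p : ℕ) : Set where
  constructor mod-by
  field divides-difference : + p ∣ (x ℤ.- y)
open _≡_mod_

_≡?_mod_ : ∀ x y p → Dec (x ≡ y mod p)
x ≡? y mod p = map′ mod-by divides-difference (+ p ∣? (x ℤ.- y))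

divides⇒mod : ∀ {p x y a} → a ≡ x ℤ.- y → + p ∣ a → x ≡ y mod p
divides⇒mod {p} a≡x-y p∣a = mod-by (subst (+ p ∣_) a≡x-y p∣a)

mod-refl : ∀ {p} x → x ≡ x mod p
mod-refl x = divides⇒mod (Eq.sym (+-inverseʳ x)) (divides 0ℤ refl)

mod-sym : ∀ {p x y} → x ≡ y mod p → y ≡ x mod p
mod-sym {x = x} {y} (mod-by d) =
  divides⇒mod (solve 2 (λ x y → :- (x :- y) := y :- x) refl x y) (∣m⇒∣-m d)

mod-trans : ∀ {p x y z} → x ≡ y mod p → y ≡ z mod p → x ≡ z mod p
mod-trans {x = x} {y} {z} (mod-by d) (mod-by e) =
  divides⇒mod (solve 3 (λ x y z → (x :- y) :+ (y :- z) := x :- z) refl x y z) (∣m∣n⇒∣m+n d e)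

mod-+ˡ : ∀ {p} a {x y} → x ≡ y mod p → a ℤ.+ x ≡ a ℤ.+ y mod p
mod-+ˡ a {x} {y} (mod-by d) =
  divides⇒mod (solve 3 (λ a x y → x :- y := (a :+ x) :- (a :+ y)) refl a x y) d

mod-*ˡ : ∀ {p} a {x y} → x ≡ y mod p → a ℤ.* x ≡ a ℤ.* y mod p
mod-*ˡ a {x} {y} (mod-by d) =
  divides⇒mod (solve 3 (λ a x y → a :* (x :- y) := (a :* x) :- (a :* y)) refl a x y) (∣n⇒∣m*n a d)

mod-multiple : ∀ {p} x m → x ℤ.+ m ℤ.* + p ≡ x mod p
mod-multiple {p} x m =
  divides⇒mod (solve 3 (λ x m p → m :* p := (x :+ m :* p) :- x) refl x m (+ p)) (∣n⇒∣m*n m ∣-refl)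

mod-residue : ∀ x p .{{_ : NonZero p}} → x ≡ + (x %ℕ p) mod p
mod-residue x p = mod-by (divides (x /ℕ p) (begin
  x ℤ.- + r                           ≡⟨ cong (ℤ._- + r) (a≡a%ℕn+[a/ℕn]*n x p) ⟩
  (+ r ℤ.+ (x /ℕ p) ℤ.* + p) ℤ.- + r  ≡⟨ solve 3 (λ r q p → (r :+ q :* p) :- r := q :* p) refl (+ r) (x /ℕ p) (+ p) ⟩
  (x /ℕ p) ℤ.* + p                    ∎))
  where
  open Eq.≡-Reasoning
  r : ℕ
  r = x %ℕ p

mod⇒multiple : ∀ {p x y} → x ≡ y mod p → Σ ℤ λ q → x ≡ y ℤ.+ q ℤ.* + p
mod⇒multiple {p} {x} {y} (mod-by (divides q x-y≡qp)) = q , (begin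
  x                  ≡⟨ solve 2 (λ x y → x := y :+ (x :- y)) refl x y ⟩
  y ℤ.+ (x ℤ.- y)    ≡⟨ cong (λ d → y ℤ.+ d) x-y≡qp ⟩
  y ℤ.+ q ℤ.* + p    ∎)
  where open Eq.≡-Reasoning

mod-zero⇒∣ : ∀ {p x} → x ≡ 0ℤ mod p → + p Unsigned.∣ x
mod-zero⇒∣ {p} {x} (mod-by d) = ∣⇒∣ᵤ (subst (+ p ∣_) (+-identityʳ x) d)

∣⇒mod-zero : ∀ {p x} → + p Unsigned.∣ x → x ≡ 0ℤ mod p
∣⇒mod-zero {x = x} d = divides⇒mod (Eq.sym (+-identityʳ x)) (∣ᵤ⇒∣ d)

module Stabilizers {c ℓ} (K : CommutativeRing c ℓ) where
  open CommutativeRing K renaming (refl to ≈-refl)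
  open Theory K

  limit-unique : ∀ {a : ℕ → Carrier} {v w} →
                 Eventually (λ n → a n ≈ v) → Eventually (λ n → a n ≈ w) → v ≈ w
  limit-unique ev ew = proj₂ (eventually-witness (eventually-zip (λ _ av aw → trans (sym av) aw) ev ew))

  finalValue : ∀ {α} (s : Stabilizer α) (u : 𝒜) → FinalValue α u (π s u)
  finalValue s u = proj₂ (s u)

  PeriodicWith : ℕ → (ℤ → Carrier) → Set ℓ
  PeriodicWith p f = ∀ x m → f (x ℤ.+ m ℤ.* + p) ≈ f x

  periodic-respects : ∀ {p f} → PeriodicWith p f → ∀ {x y} → x ≡ y mod p → f x ≈ f y
  periodic-respects {f = f} hf x≡y with mod⇒multiple x≡y
  ... | q , x≡y+qp = trans (reflexive (cong f x≡y+qp)) (hf _ q)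

  π-one : (s : Stabilizer oneₛ) → π s ≈ᶠ ev₁
  π-one s u = limit-unique (finalValue s u) (0 , λ _ _ → ≈-refl)

  π≈θ⇒zeroStabilizer : ∀ {α} (s : Stabilizer α) → π s ≈ᶠ θ → ZeroStabilizer α
  π≈θ⇒zeroStabilizer s π≈θ u = eventually-map (λ _ h → trans h (π≈θ u)) (finalValue s u)

  zeroStabilizer⇒π≈θ : ∀ {α} (s : Stabilizer α) → ZeroStabilizer α → π s ≈ᶠ θ
  zeroStabilizer⇒π≈θ s z u = limit-unique (finalValue s u) (z u)

  -- A sequence in C₀ is eventually ≡ 0 modulo the period of any u.
  C₀⇒zeroStabilizer : ∀ {α} → C₀ α → ZeroStabilizer α
  C₀⇒zeroStabilizer c₀ (mk𝒜 f (p , 0<p , hf)) =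
    eventually-map (λ _ p∣αk → periodic-respects hf (∣⇒mod-zero p∣αk)) (c₀ p 0<p)

  EventuallyConstantMod : ℕ → (ℕ → ℤ) → Set
  EventuallyConstantMod p β = Σ ℕ λ M → ∀ m n → M ≤ m → M ≤ n → β m ≡ β n mod p

  inner-finalValue :
    ∀ {β} (sβ : Stabilizer β) {p} {f : ℤ → Carrier} → PeriodicWith p f →
    (op : ℤ → ℤ → ℤ) → (∀ a {x y} → x ≡ y mod p → op a x ≡ op a y mod p) →
    (S : ℤ → 𝒜) → (∀ x y → fn (S x) y ≈ f (op x y)) →
    EventuallyConstantMod p β → Eventually (λ n → ∀ x → f (op x (β n)) ≈ π sβ (S x))
  inner-finalValue {β} sβ hf op op-resp S hS (M , β-const) = M , λ n M≤n x →
    let (m , M≤m , Sβm≈π) = eventually-witness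
                              (eventually-zip (λ _ → _,_) (eventually-≥ M) (finalValue sβ (S x)))
    in trans (periodic-respects hf (op-resp x (β-const n m M≤n M≤m)))
             (trans (sym (hS x (β m))) Sβm≈π)

  π-op : ∀ {α β} (sα : Stabilizer α) (sβ : Stabilizer β)
         (op : ℤ → ℤ → ℤ) (sγ : Stabilizer (λ n → op (α n) (β n)))
         (u : 𝒜) {p} → PeriodicWith p (fn u) → EventuallyConstantMod p β →
         (∀ a {x y} → x ≡ y mod p → op a x ≡ op a y mod p) →
         (S : ℤ → 𝒜) → (∀ x y → fn (S x) y ≈ fn u (op x y)) →
         (G : 𝒜) → (∀ x → fn G x ≈ π sβ (S x)) →
         π sγ u ≈ π sα G
  π-op {α} sα sβ op sγ u hf β-const op-resp S hS G hG =
    limit-unique (finalValue sγ u)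
      (eventually-zip (λ n inner outer → trans (inner (α n)) (trans (sym (hG (α n))) outer))
                      (inner-finalValue sβ hf op op-resp S hS β-const)
                      (finalValue sα G))

  module Nontrivial (1≉0 : ¬ (1# ≈ 0#)) where

    -- π α is a character: every defining identity holds along α, hence at the final value.
    π-character : ∀ {α} (s : Stabilizer α) → IsCharacter (π s)
    π-character {α} s = record
      { cong           = λ {u} {v} u≈v →
          limit-unique (finalValue s u) (eventually-map (λ n → trans (u≈v (α n))) (finalValue s v))
      ; additive       = λ u v →
          limit-unique (finalValue s (u +𝒜 v)) (eventually-zip (λ _ → +-cong) (finalValue s u) (finalValue s v))
      ; homogeneous    = λ a u →
          limit-unique (finalValue s (a ·𝒜 u)) (eventually-map (λ _ → *-congˡ) (finalValue s u))
      ; multiplicative = λ u v →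
          limit-unique (finalValue s (u *𝒜 v)) (eventually-zip (λ _ → *-cong) (finalValue s u) (finalValue s v))
      ; nonzero        = one𝒜 , λ π1≈0 → 1≉0 (trans (sym π1≈1) π1≈0)
      }
      where
      one𝒜 : 𝒜
      one𝒜 = mk𝒜 (λ _ → 1#) (1 , z<s , λ _ _ → ≈-refl)
      π1≈1 : π s one𝒜 ≈ 1#
      π1≈1 = limit-unique (finalValue s one𝒜) (0 , λ _ _ → ≈-refl)

    indicatorFn : ℕ → ℤ → ℤ → Carrier
    indicatorFn p r x with x ≡? r mod p
    ... | yes _ = 1#
    ... | no  _ = 0#

    indicator-respects : ∀ p r {x y} → x ≡ y mod p → indicatorFn p r x ≈ indicatorFn p r y
    indicator-respects p r {x} {y} x≡y with x ≡? r mod p | y ≡? r mod p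
    ... | yes _   | yes _   = ≈-refl
    ... | no  _   | no  _   = ≈-refl
    ... | yes x≡r | no  y≢r = ⊥-elim (y≢r (mod-trans (mod-sym x≡y) x≡r))
    ... | no  x≢r | yes y≡r = ⊥-elim (x≢r (mod-trans x≡y y≡r))

    indicator : (p : ℕ) → 0 < p → ℤ → 𝒜
    indicator p 0<p r =
      mk𝒜 (indicatorFn p r) (p , 0<p , λ x m → indicator-respects p r (mod-multiple x m))

    indicator-yes : ∀ p r {x} → x ≡ r mod p → indicatorFn p r x ≈ 1#
    indicator-yes p r {x} x≡r with x ≡? r mod p
    ... | yes _   = ≈-refl
    ... | no  x≢r = ⊥-elim (x≢r x≡r)

    -- The converse needs 1 ≉ 0.
    indicator-one : ∀ p r {x} → indicatorFn p r x ≈ 1# → x ≡ r mod p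
    indicator-one p r {x} with x ≡? r mod p
    ... | yes x≡r = λ _ → x≡r
    ... | no  _   = λ 0≈1 → ⊥-elim (1≉0 (sym 0≈1))

    -- A stabilizer is eventually constant modulo every p > 0: past the thresholds of
    -- all p residue-class indicators, the class of α M has final value 1.
    stabilizer-constantMod : ∀ {α} → Stabilizer α → (p : ℕ) → 0 < p → EventuallyConstantMod p α
    stabilizer-constantMod {α} s p 0<p =
      M , λ m n M≤m M≤n → mod-trans (inClass m M≤m) (mod-sym (inClass n M≤n))
      where
      instance
        p≢0 : NonZero p
        p≢0 = >-nonZero 0<p
      class : ℕ → 𝒜
      class i = indicator p 0<p (+ i)
      settled : Eventually (λ n → ∀ i → i < p → fn (class i) (α n) ≈ π s (class i))
      settled = eventually-all p (λ i _ → finalValue s (class i))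
      M : ℕ
      M = proj₁ settled
      r : ℕ
      r = α M %ℕ p
      inClass : ∀ n → M ≤ n → α n ≡ + r mod p
      inClass n M≤n = indicator-one p (+ r) (begin
        fn (class r) (α n)   ≈⟨ proj₂ settled n M≤n r (n%ℕd<d (α M) p) ⟩
        π s (class r)        ≈⟨ sym (proj₂ settled M ≤-refl r (n%ℕd<d (α M) p)) ⟩
        fn (class r) (α M)   ≈⟨ indicator-yes p (+ r) (mod-residue (α M) p) ⟩
        1#                   ∎)
        where open import Relation.Binary.Reasoning.Setoid setoid

    -- The inner and outer functions of π-op are those in the definitions of ⊕ and
    -- ⊙, so their defining identities hold by reflexivity.
    π-⊕ : ∀ {α β} (sα : Stabilizer α) (sβ : Stabilizer β) (sαβ : Stabilizer (α +ₛ β))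
          (cα : IsCharacter (π sα)) (cβ : IsCharacter (π sβ)) →
          π sαβ ≈ᶠ ((π sα , cα) ⊕ (π sβ , cβ))
    π-⊕ sα sβ sαβ _ _ u@(mk𝒜 f (p , 0<p , hf)) =
      π-op sα sβ ℤ._+_ sαβ u hf (stabilizer-constantMod sβ p 0<p) mod-+ˡ
           _ (λ _ _ → ≈-refl) _ (λ _ → ≈-refl)

    π-⊙ : ∀ {α β} (sα : Stabilizer α) (sβ : Stabilizer β) (sαβ : Stabilizer (α *ₛ β))
          (cα : IsCharacter (π sα)) (cβ : IsCharacter (π sβ)) →
          π sαβ ≈ᶠ ((π sα , cα) ⊙ (π sβ , cβ))
    π-⊙ sα sβ sαβ _ _ u@(mk𝒜 f (p , 0<p , hf)) =
      π-op sα sβ ℤ._*_ sαβ u hf (stabilizer-constantMod sβ p 0<p) mod-*ˡ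
           _ (λ _ _ → ≈-refl) _ (λ _ → ≈-refl)

    -- A zero stabilizer eventually lands in the class of 0 mod n.
    zeroStabilizer⇒C₀ : ∀ {α} → ZeroStabilizer α → C₀ α
    zeroStabilizer⇒C₀ z n 0<n =
      eventually-map (λ _ h → mod-zero⇒∣ (indicator-one n 0ℤ (trans h (indicator-yes n 0ℤ (mod-refl 0ℤ)))))
                     (z (indicator n 0<n 0ℤ))

mainTheorem17 : ∀ {c ℓ} (K : CommutativeRing c ℓ) → IsFieldCR K →
    let open Theory K in
    (∀ (α : ℕ → ℤ) (s : Stabilizer α) → IsCharacter (π s))
    × (∀ (α β : ℕ → ℤ) (sα : Stabilizer α) (sβ : Stabilizer β)
    (sαβ : Stabilizer (α +ₛ β))
    (cα : IsCharacter (π sα)) (cβ : IsCharacter (π sβ)) →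
    π sαβ ≈ᶠ ((π sα , cα) ⊕ (π sβ , cβ)))
    × (∀ (α β : ℕ → ℤ) (sα : Stabilizer α) (sβ : Stabilizer β)
    (sαβ : Stabilizer (α *ₛ β))
    (cα : IsCharacter (π sα)) (cβ : IsCharacter (π sβ)) →
    π sαβ ≈ᶠ ((π sα , cα) ⊙ (π sβ , cβ)))
    × (∀ (s : Stabilizer oneₛ) → π s ≈ᶠ ev₁)
    × (∀ (α : ℕ → ℤ) (s : Stabilizer α) →
    (π s ≈ᶠ θ → C₀ α)
    × (C₀ α → π s ≈ᶠ θ))
    × (∀ (α : ℕ → ℤ) → (ZeroStabilizer α → C₀ α) × (C₀ α → ZeroStabilizer α))
mainTheorem17 K (1≉0 , _) =
    (λ _ → π-character)
  , (λ _ _ → π-⊕)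
  , (λ _ _ → π-⊙)
  , π-one
  , (λ _ s → (λ π≈θ → zeroStabilizer⇒C₀ (π≈θ⇒zeroStabilizer s π≈θ))
           , (λ c₀ → zeroStabilizer⇒π≈θ s (C₀⇒zeroStabilizer c₀)))
  , (λ _ → zeroStabilizer⇒C₀ , C₀⇒zeroStabilizer)
  where
  open Stabilizers K
  open Nontrivial 1≉0
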